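{- Let $n\ge3$, $k\ge0$, let $S$ be an independent set in $G_n^k$ and let $i\in[n+k]$. Then (1) $\mathrm{DFCL}(i,S)$ is independent in $G_n^k$; (2) $\mathrm{DLCF}(i,S)$ is independent in $G_n^k$; (3) $|\mathrm{DFCL}(i,S)|+|\mathrm{DLCF}(i,S)|=2|S|$.
   Context: The crown $S_n^k$ is the height-2 poset on $A\cup B$, $A=\{a_1,\dots,a_{n+k}\}$ minimal, $B=\{b_1,\dots,b_{n+k}\}$ maximal, indices cyclic mod $n+k$; $a_i$ is incomparable to $b_j$ iff $j\in\{i,\dots,i+k\}$ (mod $n+k$), otherwise $a_i<b_j$. $\mathrm{Inc}(A,B)$: incomparable pairs $(a,b)\in A\times B$; $G_n^k$: graph on $\mathrm{Inc}(A,B)$ with $(a,b)\sim(x,y)$ iff $a<y$ and $x<b$. For an independent set $S$ and $i\in[n+k]$, an ordered pair $((a,b),(x,y))$ of elements of $S$ is a contraction blocking pair at $i$ if $a=a_i$, $y=b_i$ and $x<b$ in $S_n^k$. $\mathrm{FCBP}(i,S)$ is the set of $(a,b)\in S$ which are the first entry of some contraction blocking pair at $i$ in $S$, and $\mathrm{LCBP}(i,S)$ is the set of $(x,y)\in S$ which are the second entry of some contraction blocking pair at $i$ in $S$. Define $\mathrm{DFCL}(i,S)=(S-\mathrm{FCBP}(i,S))\cup\{(x,b_{i-1}):(x,y)\in\mathrm{LCBP}(i,S)\}$ and $\mathrm{DLCF}(i,S)=(S-\mathrm{LCBP}(i,S))\cup\{(a_{i+1},b):(a,b)\in\mathrm{FCBP}(i,S)\}$.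 -}

module Defs where

open import Data.Nat using (ℕ; zero; suc; _+_; _*_; _∸_; _≤ᵇ_; _≡ᵇ_)
open import Data.Bool using (Bool; true; false; _∧_; _∨_; not; if_then_else_)
open import Data.Fin using (Fin; toℕ)
open import Data.List using (List; map; allFin; concatMap)
open import Data.Bool.ListAction using (any)
open import Data.Nat.ListAction using (sum)
open import Data.Product using (_×_)
open import Relation.Binary.PropositionalEquality using (_≡_)
open import Relation.Nullary using (¬_)

-- Crown S_n^k with N = n + k; a_i, b_j indexed by Fin N (indices 0..N-1,
-- a relabelling of [n+k], cyclic mod N).

cdist : (n k : ℕ) → Fin (n + k) → Fin (n + k) → ℕ
cdist n k i j = if toℕ i ≤ᵇ toℕ j then toℕ j ∸ toℕ i else (n + k + toℕ j) ∸ toℕ i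

-- a_i incomparable to b_j  iff  j ∈ {i, ..., i+k} (mod n+k)
incB : (n k : ℕ) → Fin (n + k) → Fin (n + k) → Bool
incB n k i j = cdist n k i j ≤ᵇ k

ltB : (n k : ℕ) → Fin (n + k) → Fin (n + k) → Bool
ltB n k i j = not (incB n k i j)

-- A finite set of pairs (a_x, b_y) ∈ A × B, as its characteristic function.
PairSet : ℕ → Set
PairSet N = Fin N → Fin N → Bool

_==_ : {N : ℕ} → Fin N → Fin N → Bool
i == j = toℕ i ≡ᵇ toℕ j

predIdx : (N : ℕ) → Fin N → ℕ
predIdx N i = if toℕ i ≡ᵇ 0 then N ∸ 1 else toℕ i ∸ 1

succIdx : (N : ℕ) → Fin N → ℕ
succIdx N i = if suc (toℕ i) ≡ᵇ N then 0 else suc (toℕ i)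

Independent : (n k : ℕ) → PairSet (n + k) → Set
Independent n k S =
  (∀ a b → S a b ≡ true → incB n k a b ≡ true) ×
  (∀ a b x y → S a b ≡ true → S x y ≡ true →
     ¬ (ltB n k a y ≡ true × ltB n k x b ≡ true))

FCBP : (n k : ℕ) → PairSet (n + k) → Fin (n + k) → PairSet (n + k)
FCBP n k S i a b =
  S a b ∧ (a == i) ∧ any (λ x → S x i ∧ ltB n k x b) (allFin (n + k))

LCBP : (n k : ℕ) → PairSet (n + k) → Fin (n + k) → PairSet (n + k)
LCBP n k S i x y =
  S x y ∧ (y == i) ∧ any (λ b → S i b ∧ ltB n k x b) (allFin (n + k))

DFCL : (n k : ℕ) → PairSet (n + k) → Fin (n + k) → PairSet (n + k)
DFCL n k S i u v =
  (S u v ∧ not (FCBP n k S i u v)) ∨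
  ((toℕ v ≡ᵇ predIdx (n + k) i) ∧ any (λ y → LCBP n k S i u y) (allFin (n + k)))

DLCF : (n k : ℕ) → PairSet (n + k) → Fin (n + k) → PairSet (n + k)
DLCF n k S i u v =
  (S u v ∧ not (LCBP n k S i u v)) ∨
  ((toℕ u ≡ᵇ succIdx (n + k) i) ∧ any (λ a → FCBP n k S i a v) (allFin (n + k)))

card : {N : ℕ} → PairSet N → ℕ
card {N} S = sum (concatMap (λ a → map (λ b → if S a b then 1 else 0) (allFin N)) (allFin N))

-- In the crown a_x is incomparable exactly to a cyclic
-- window of b's starting at b_x, so for x ≠ i the moved pair stays incomparable; an
-- element (u, w) of S adjacent to a moved pair is either adjacent to the original pair
-- (impossible in S) or is (a_i, w) with x < w, and then it lies in FCBP(i,S) and was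
-- removed. Since a_i < b_{i-1} (this needs n ≥ 2), a moved pair is adjacent to the pair
-- (a_i, b) that blocks it, hence not in S; moving is injective, so
-- |DFCL| = |S| - |FCBP| + |LCBP|. Dually |DLCF| = |S| - |LCBP| + |FCBP|.

module Submission where

import Algebra.Properties.CommutativeMonoid.Sum as CommutativeMonoidSum
open import Data.Bool using (Bool; true; false; T; not; _∧_; _∨_; if_then_else_)
open import Data.Bool.Properties using (T-≡; ¬-not)
open import Data.Bool.ListAction using (any)
open import Data.Fin using (Fin; toℕ; zero; suc; _≟_)
open import Data.Fin.Properties using (toℕ<n; toℕ-injective)
open import Data.List using (List; []; _∷_; map; concatMap; tabulate; allFin)
open import Data.List.Properties using (map-tabulate)
open import Data.List.Membership.Propositional using (lose)
open import Data.List.Membership.Propositional.Properties using (∈-allFin)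
open import Data.List.Relation.Unary.Any using (satisfied)
open import Data.List.Relation.Unary.Any.Properties using (any⁺; any⁻)
open import Data.Nat using (ℕ; zero; suc; _+_; _*_; _∸_; _≤_; _<_; _≤ᵇ_; _≡ᵇ_; _≤?_; s≤s⁻¹; z<s)
open import Data.Nat.Properties hiding (_≟_)
open import Data.Nat.ListAction using (sum)
open import Data.Nat.ListAction.Properties using (sum-++)
open import Data.Nat.Solver using (module +-*-Solver)
open import Data.Product using (_×_; _,_; proj₁; proj₂; ∃-syntax; swap)
open import Data.Sum using (_⊎_; inj₁; inj₂)
open import Function using (_∘_; module Equivalence)
open import Relation.Nullary using (¬_; yes; no; contradiction)
open import Relation.Binary.PropositionalEquality
open import Defs

open Equivalence using (to; from)
open CommutativeMonoidSum +-0-commutativeMonoid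
  using (sum-syntax; sum-cong-≗; ∑-distrib-+; ∑-comm; sum-replicate-zero)

indicator : Bool → ℕ
indicator b = if b then 1 else 0

∧-true⁺ : ∀ {x y} → x ≡ true → y ≡ true → x ∧ y ≡ true
∧-true⁺ refl refl = refl

∧-true⁻ : ∀ {x y} → x ∧ y ≡ true → x ≡ true × y ≡ true
∧-true⁻ {true} y≡true = refl , y≡true

∨-true⁻ : ∀ {x y} → x ∨ y ≡ true → x ≡ true ⊎ y ≡ true
∨-true⁻ {true}  _      = inj₁ refl
∨-true⁻ {false} y≡true = inj₂ y≡true

not-true⁻ : ∀ {x} → not x ≡ true → x ≡ false
not-true⁻ {false} _ = refl

∧-guard : ∀ {x c y} → (c ≡ true → x ≡ y) → (x ≡ true → c ≡ true) → x ≡ c ∧ y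
∧-guard {c = true}            x≡y _   = x≡y refl
∧-guard {false} {c = false}   _   _   = refl
∧-guard {true}  {c = false}   _   x⇒c = sym (x⇒c refl)

==⇒≡ : ∀ {N} {u v : Fin N} → (u == v) ≡ true → u ≡ v
==⇒≡ e = toℕ-injective (≡ᵇ⇒≡ _ _ (from T-≡ e))

≡⇒== : ∀ {N} {u v : Fin N} → u ≡ v → (u == v) ≡ true
≡⇒== {u = u} refl = to T-≡ (≡⇒≡ᵇ (toℕ u) (toℕ u) refl)

any-allFin⁺ : ∀ {m} (f : Fin m → Bool) j → f j ≡ true → any f (allFin m) ≡ true
any-allFin⁺ f j fj = to T-≡ (any⁺ f (lose (∈-allFin j) (from T-≡ fj)))

any-allFin⁻ : ∀ {m} (f : Fin m → Bool) → any f (allFin m) ≡ true → ∃[ j ] f j ≡ true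
any-allFin⁻ f e with satisfied (any⁻ f (allFin _) (from T-≡ e))
... | j , fj = j , to T-≡ fj

any-allFin-unique : ∀ {m} (f : Fin m → Bool) j → (∀ v → f v ≡ true → v ≡ j) →
                    any f (allFin m) ≡ f j
any-allFin-unique f j unique with f j in fj
... | true  = any-allFin⁺ f j fj
... | false = ¬-not λ anyf → let v , fv = any-allFin⁻ f anyf in
  contradiction (trans (sym (subst (λ w → f w ≡ true) (unique v fv) fv)) fj) λ ()

-- Cyclic distance

cyclicDist : ℕ → ℕ → ℕ → ℕ
cyclicDist N p q = if p ≤ᵇ q then q ∸ p else N + q ∸ p

data CyclicSucc (N : ℕ) : ℕ → ℕ → Set where
  step : ∀ {p} → suc p < N → CyclicSucc N p (suc p)
  wrap : ∀ {p} → suc p ≡ N → CyclicSucc N p 0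

CyclicSucc-<ˡ : ∀ {N p q} → CyclicSucc N p q → p < N
CyclicSucc-<ˡ (step sp<N) = <⇒≤ sp<N
CyclicSucc-<ˡ (wrap refl) = ≤-refl

CyclicSucc-<ʳ : ∀ {N p q} → CyclicSucc N p q → q < N
CyclicSucc-<ʳ (step sp<N) = sp<N
CyclicSucc-<ʳ (wrap refl) = z<s

predIdx-cyclicSucc : ∀ {N} (i : Fin N) → CyclicSucc N (predIdx N i) (toℕ i)
predIdx-cyclicSucc {suc _} zero    = wrap refl
predIdx-cyclicSucc {suc _} (suc j) = step (toℕ<n (suc j))

cyclicSucc-succIdx : ∀ {N} (i : Fin N) → CyclicSucc N (toℕ i) (succIdx N i)
cyclicSucc-succIdx {N} i = wrapOrStep (suc (toℕ i) ≡ᵇ N) refl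
  where
  wrapOrStep : ∀ b → (suc (toℕ i) ≡ᵇ N) ≡ b →
               CyclicSucc N (toℕ i) (if b then 0 else suc (toℕ i))
  wrapOrStep true  e = wrap (≡ᵇ⇒≡ _ _ (from T-≡ e))
  wrapOrStep false e = step (≤∧≢⇒< (toℕ<n i) λ i+1≡N → subst T e (≡⇒≡ᵇ _ _ i+1≡N))

cyclicDist-≤ : ∀ N {p q} → p ≤ q → cyclicDist N p q ≡ q ∸ p
cyclicDist-≤ N p≤q rewrite to T-≡ (≤⇒≤ᵇ p≤q) = refl

cyclicDist-> : ∀ N {p q} → q < p → cyclicDist N p q ≡ N + q ∸ p
cyclicDist-> N {p} {q} q<p with p ≤ᵇ q in p≤ᵇq
... | true  = contradiction (≤ᵇ⇒≤ p q (from T-≡ p≤ᵇq)) (<⇒≱ q<p)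
... | false = refl

cyclicDist-succʳ : ∀ {N u p q} → u < N → CyclicSucc N p q → u ≢ q →
                   cyclicDist N u q ≡ suc (cyclicDist N u p)
cyclicDist-succʳ {N} {u} {p} u<N (step _) u≢q with u ≤? p
... | yes u≤p = begin
  cyclicDist N u (suc p)  ≡⟨ cyclicDist-≤ N (m≤n⇒m≤1+n u≤p) ⟩
  suc p ∸ u               ≡⟨ +-∸-assoc 1 u≤p ⟩
  suc (p ∸ u)             ≡⟨ cong suc (cyclicDist-≤ N u≤p) ⟨
  suc (cyclicDist N u p)  ∎
  where open ≡-Reasoning
... | no u≰p = begin
  cyclicDist N u (suc p)  ≡⟨ cyclicDist-> N (≤∧≢⇒< (≰⇒> u≰p) (u≢q ∘ sym)) ⟩
  N + suc p ∸ u           ≡⟨ cong (_∸ u) (+-suc N p) ⟩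
  suc (N + p) ∸ u         ≡⟨ +-∸-assoc 1 (≤-trans (<⇒≤ u<N) (m≤m+n N p)) ⟩
  suc (N + p ∸ u)         ≡⟨ cong suc (cyclicDist-> N (≰⇒> u≰p)) ⟨
  suc (cyclicDist N u p)  ∎
  where open ≡-Reasoning
cyclicDist-succʳ {u = u} {p} u<N (wrap refl) u≢0 = begin
  cyclicDist (suc p) u 0        ≡⟨ cyclicDist-> (suc p) (n≢0⇒n>0 u≢0) ⟩
  suc p + 0 ∸ u                 ≡⟨ cong (_∸ u) (+-identityʳ (suc p)) ⟩
  suc p ∸ u                     ≡⟨ +-∸-assoc 1 (s≤s⁻¹ u<N) ⟩
  suc (p ∸ u)                   ≡⟨ cong suc (cyclicDist-≤ (suc p) (s≤s⁻¹ u<N)) ⟨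
  suc (cyclicDist (suc p) u p)  ∎
  where open ≡-Reasoning

cyclicDist-succˡ : ∀ {N b p q} → b < N → CyclicSucc N p q → b ≢ p →
                   cyclicDist N p b ≡ suc (cyclicDist N q b)
cyclicDist-succˡ {N} {b} {p} b<N (step p+1<N) b≢p with b ≤? p
... | yes b≤p = begin
  cyclicDist N p b               ≡⟨ cyclicDist-> N b<p ⟩
  suc (N + b) ∸ suc p            ≡⟨ +-∸-assoc 1 (≤-trans (<⇒≤ p+1<N) (m≤m+n N b)) ⟩
  suc (N + b ∸ suc p)            ≡⟨ cong suc (cyclicDist-> N (m<n⇒m<1+n b<p)) ⟨
  suc (cyclicDist N (suc p) b)   ∎
  where
  open ≡-Reasoning
  b<p : b < p
  b<p = ≤∧≢⇒< b≤p b≢p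
... | no b≰p = begin
  cyclicDist N p b               ≡⟨ cyclicDist-≤ N (<⇒≤ (≰⇒> b≰p)) ⟩
  suc b ∸ suc p                  ≡⟨ +-∸-assoc 1 (≰⇒> b≰p) ⟩
  suc (b ∸ suc p)                ≡⟨ cong suc (cyclicDist-≤ N (≰⇒> b≰p)) ⟨
  suc (cyclicDist N (suc p) b)   ∎
  where open ≡-Reasoning
cyclicDist-succˡ {b = b} {p} b<N (wrap refl) b≢p = begin
  cyclicDist (suc p) p b  ≡⟨ cyclicDist-> (suc p) (≤∧≢⇒< (s≤s⁻¹ b<N) b≢p) ⟩
  suc (p + b) ∸ p         ≡⟨ cong (λ m → suc m ∸ p) (+-comm p b) ⟩
  suc b + p ∸ p           ≡⟨ m+n∸n≡m (suc b) p ⟩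
  suc b                   ∎
  where open ≡-Reasoning

cyclicDist-fromSucc : ∀ {N p q} → CyclicSucc N p q → suc (cyclicDist N q p) ≡ N
cyclicDist-fromSucc {N} {p} (step p+1<N) = begin
  suc (cyclicDist N (suc p) p)  ≡⟨ cong suc (cyclicDist-> N (n<1+n p)) ⟩
  suc (N + p ∸ suc p)           ≡⟨ +-∸-assoc 1 (≤-trans (<⇒≤ p+1<N) (m≤m+n N p)) ⟨
  N + p ∸ p                     ≡⟨ m+n∸n≡m N p ⟩
  N                             ∎
  where open ≡-Reasoning
cyclicDist-fromSucc (wrap p+1≡N) = p+1≡N

-- Counting

sum-concatMap : ∀ {A : Set} (g : A → List ℕ) xs → sum (concatMap g xs) ≡ sum (map (sum ∘ g) xs)
sum-concatMap g []       = refl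
sum-concatMap g (x ∷ xs) =
  trans (sum-++ (g x) (concatMap g xs)) (cong (sum (g x) +_) (sum-concatMap g xs))

sum-tabulate : ∀ {m} (f : Fin m → ℕ) → sum (tabulate f) ≡ ∑[ i < m ] f i
sum-tabulate {zero}  f = refl
sum-tabulate {suc m} f = cong (f zero +_) (sum-tabulate (f ∘ suc))

sum-map-allFin : ∀ {m} (f : Fin m → ℕ) → sum (map f (allFin m)) ≡ ∑[ i < m ] f i
sum-map-allFin f = trans (cong sum (map-tabulate (λ i → i) f)) (sum-tabulate f)

card≡∑ : ∀ {N} (P : PairSet N) → card P ≡ ∑[ a < N ] ∑[ b < N ] indicator (P a b)
card≡∑ {N} P = begin
  card P                                   ≡⟨ sum-concatMap row (allFin N) ⟩
  sum (map (sum ∘ row) (allFin N))         ≡⟨ sum-map-allFin (sum ∘ row) ⟩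
  ∑[ a < N ] sum (row a)                   ≡⟨ sum-cong-≗ {N} (sum-map-allFin ∘ ind) ⟩
  ∑[ a < N ] ∑[ b < N ] indicator (P a b)  ∎
  where
  open ≡-Reasoning
  ind : Fin N → Fin N → ℕ
  ind a b = indicator (P a b)
  row : Fin N → List ℕ
  row a = map (ind a) (allFin N)

card-+ : ∀ {N} (P Q : PairSet N) →
         card P + card Q ≡ ∑[ a < N ] ∑[ b < N ] (indicator (P a b) + indicator (Q a b))
card-+ {N} P Q = begin
  card P + card Q                    ≡⟨ cong₂ _+_ (card≡∑ P) (card≡∑ Q) ⟩
  ∑[ a < N ] ∑P a + ∑[ a < N ] ∑Q a  ≡⟨ ∑-distrib-+ ∑P ∑Q ⟨
  ∑[ a < N ] (∑P a + ∑Q a)           ≡⟨ sum-cong-≗ {N} (λ a → ∑-distrib-+ (λ b → indicator (P a b)) _) ⟨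
  ∑[ a < N ] ∑[ b < N ] (indicator (P a b) + indicator (Q a b))  ∎
  where
  open ≡-Reasoning
  ∑P ∑Q : Fin N → ℕ
  ∑P a = ∑[ b < N ] indicator (P a b)
  ∑Q a = ∑[ b < N ] indicator (Q a b)

card-+-cong : ∀ {N} (P Q R T : PairSet N) →
  (∀ a b → indicator (P a b) + indicator (Q a b) ≡ indicator (R a b) + indicator (T a b)) →
  card P + card Q ≡ card R + card T
card-+-cong {N} P Q R T pointwise =
  trans (card-+ P Q)
        (trans (sum-cong-≗ {N} (λ a → sum-cong-≗ {N} (pointwise a))) (sym (card-+ R T)))

∑-indicator-select : ∀ {m} p → p < m → (b : Bool) → ∑[ v < m ] indicator ((toℕ v ≡ᵇ p) ∧ b) ≡ indicator b
∑-indicator-select {suc m} zero    _   b =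
  trans (cong (indicator b +_) (sum-replicate-zero m)) (+-identityʳ _)
∑-indicator-select {suc m} (suc p) p<m b = ∑-indicator-select p (s≤s⁻¹ p<m) b

exchanges⇒double : ∀ d d′ f l s → d + f ≡ s + l → d′ + l ≡ s + f → d + d′ ≡ 2 * s
exchanges⇒double d d′ f l s e e′ = +-cancelʳ-≡ (f + l) (d + d′) (2 * s) (begin
  d + d′ + (f + l)       ≡⟨ regroup d d′ f l ⟩
  (d + f) + (d′ + l)     ≡⟨ cong₂ _+_ e e′ ⟩
  (s + l) + (s + f)      ≡⟨ collect s l f ⟩
  2 * s + (f + l)        ∎)
  where
  open ≡-Reasoning
  open +-*-Solver
  regroup : ∀ a b c d → a + b + (c + d) ≡ (a + c) + (b + d)
  regroup = solve 4 (λ a b c d → a :+ b :+ (c :+ d) := (a :+ c) :+ (b :+ d)) refl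
  collect : ∀ s l f → (s + l) + (s + f) ≡ 2 * s + (f + l)
  collect = solve 3 (λ s l f → (s :+ l) :+ (s :+ f) := con 2 :* s :+ (f :+ l)) refl

module _ {N : ℕ} where

  replace : PairSet N → PairSet N → PairSet N → PairSet N
  replace S R A a b = (S a b ∧ not (R a b)) ∨ A a b

  columnSet : ℕ → (Fin N → Bool) → PairSet N
  columnSet p c a b = (toℕ b ≡ᵇ p) ∧ c a

  rowSet : ℕ → (Fin N → Bool) → PairSet N
  rowSet p c a b = (toℕ a ≡ᵇ p) ∧ c b

  columnSet⁻ : ∀ p c {a b} → columnSet p c a b ≡ true → toℕ b ≡ p × c a ≡ true
  columnSet⁻ p c {b = b} e =
    let b=p , ca = ∧-true⁻ {toℕ b ≡ᵇ p} e in ≡ᵇ⇒≡ _ _ (from T-≡ b=p) , ca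

  rowSet⁻ : ∀ p c {a b} → rowSet p c a b ≡ true → toℕ a ≡ p × c b ≡ true
  rowSet⁻ p c {a = a} e =
    let a=p , cb = ∧-true⁻ {toℕ a ≡ᵇ p} e in ≡ᵇ⇒≡ _ _ (from T-≡ a=p) , cb

  card-replace : (S R A : PairSet N) →
    (∀ a b → R a b ≡ true → S a b ≡ true) → (∀ a b → A a b ≡ true → S a b ≡ false) →
    card (replace S R A) + card R ≡ card S + card A
  card-replace S R A R⊆S A∩S≡∅ =
    card-+-cong (replace S R A) R S A λ a b →
      pointwise (S a b) (R a b) (A a b) (R⊆S a b) (A∩S≡∅ a b)
    where
    pointwise : ∀ s r x → (r ≡ true → s ≡ true) → (x ≡ true → s ≡ false) →
                indicator ((s ∧ not r) ∨ x) + indicator r ≡ indicator s + indicator x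
    pointwise true  r     true  _   x⇒¬s with () ← x⇒¬s refl
    pointwise false true  x     r⇒s _    with () ← r⇒s refl
    pointwise true  true  false _   _    = refl
    pointwise true  false false _   _    = refl
    pointwise false false true  _   _    = refl
    pointwise false false false _   _    = refl

  card-column : ∀ {p} (P : PairSet N) (c : Fin N → Bool) → p < N →
    (∀ a b → P a b ≡ columnSet p c a b) → card P ≡ ∑[ a < N ] indicator (c a)
  card-column {p} P c p<N P≡ = trans (card≡∑ P) (sum-cong-≗ {N} λ a →
    trans (sum-cong-≗ {N} (cong indicator ∘ P≡ a)) (∑-indicator-select p p<N (c a)))

  card-row : ∀ {p} (P : PairSet N) (c : Fin N → Bool) → p < N →
    (∀ a b → P a b ≡ rowSet p c a b) → card P ≡ ∑[ b < N ] indicator (c b)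
  card-row {p} P c p<N P≡ = trans (card≡∑ P) (trans (∑-comm {N} {N} _) (sum-cong-≗ {N} λ b →
    trans (sum-cong-≗ {N} (λ a → cong indicator (P≡ a b))) (∑-indicator-select p p<N (c b))))

-- The crown

module Crown (n k : ℕ) where

  -- cdist n k u v unfolds to cyclicDist (n + k) (toℕ u) (toℕ v).
  incB⇒cyclicDist≤ : ∀ {u v} → incB n k u v ≡ true → cyclicDist (n + k) (toℕ u) (toℕ v) ≤ k
  incB⇒cyclicDist≤ inc = ≤ᵇ⇒≤ _ _ (from T-≡ inc)

  cyclicDist≤⇒incB : ∀ {u v} → cyclicDist (n + k) (toℕ u) (toℕ v) ≤ k → incB n k u v ≡ true
  cyclicDist≤⇒incB d≤k = to T-≡ (≤⇒≤ᵇ d≤k)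

  ltB⇒¬incB : ∀ u v → ltB n k u v ≡ true → ¬ incB n k u v ≡ true
  ltB⇒¬incB _ _ u<v inc with () ← subst (λ b → not b ≡ true) inc u<v

  incB-predʳ : ∀ {u v j} → CyclicSucc (n + k) (toℕ v) (toℕ j) → u ≢ j →
               incB n k u j ≡ true → incB n k u v ≡ true
  incB-predʳ {u} {v} {j} v↝j u≢j inc = cyclicDist≤⇒incB {u} {v} (begin
    cyclicDist (n + k) (toℕ u) (toℕ v)        ≤⟨ n≤1+n _ ⟩
    suc (cyclicDist (n + k) (toℕ u) (toℕ v))  ≡⟨ cyclicDist-succʳ (toℕ<n u) v↝j (u≢j ∘ toℕ-injective) ⟨
    cyclicDist (n + k) (toℕ u) (toℕ j)        ≤⟨ incB⇒cyclicDist≤ {u} {j} inc ⟩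
    k                                         ∎)
    where open ≤-Reasoning

  incB-succˡ : ∀ {u v j} → CyclicSucc (n + k) (toℕ j) (toℕ u) → v ≢ j →
               incB n k j v ≡ true → incB n k u v ≡ true
  incB-succˡ {u} {v} {j} j↝u v≢j inc = cyclicDist≤⇒incB {u} {v} (begin
    cyclicDist (n + k) (toℕ u) (toℕ v)        ≤⟨ n≤1+n _ ⟩
    suc (cyclicDist (n + k) (toℕ u) (toℕ v))  ≡⟨ cyclicDist-succˡ (toℕ<n v) j↝u (v≢j ∘ toℕ-injective) ⟨
    cyclicDist (n + k) (toℕ j) (toℕ v)        ≤⟨ incB⇒cyclicDist≤ {j} {v} inc ⟩
    k                                         ∎)
    where open ≤-Reasoning

  ltB-cyclicSucc : 2 ≤ n → ∀ {p q} → CyclicSucc (n + k) (toℕ p) (toℕ q) → ltB n k q p ≡ true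
  ltB-cyclicSucc 2≤n {p} {q} p↝q = cong not (¬-not λ inc → <⇒≱ k<d (incB⇒cyclicDist≤ {q} {p} inc))
    where
    k<d : k < cyclicDist (n + k) (toℕ q) (toℕ p)
    k<d = s≤s⁻¹ (≤-trans (+-monoˡ-≤ k 2≤n) (≤-reflexive (sym (cyclicDist-fromSucc p↝q))))

  Adjacent : (a b x y : Fin (n + k)) → Set
  Adjacent a b x y = ltB n k a y ≡ true × ltB n k x b ≡ true

  replace-independent : ∀ {S R A} → Independent n k S →
    (∀ a b → A a b ≡ true → incB n k a b ≡ true) →
    (∀ a b x y → A a b ≡ true → S x y ≡ true → R x y ≡ false → ¬ Adjacent a b x y) →
    (∀ a b x y → A a b ≡ true → A x y ≡ true → ¬ Adjacent a b x y) →
    Independent n k (replace S R A)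
  replace-independent {S} {R} {A} (S⊆Inc , S-indep) A⊆Inc A-S A-A = ⊆Inc , indep
    where
    kept-or-added : ∀ {a b} → replace S R A a b ≡ true → (S a b ≡ true × R a b ≡ false) ⊎ A a b ≡ true
    kept-or-added {a} {b} e with ∨-true⁻ {S a b ∧ not (R a b)} e
    ... | inj₁ kept  = let s , r = ∧-true⁻ {S a b} kept in inj₁ (s , not-true⁻ r)
    ... | inj₂ added = inj₂ added

    ⊆Inc : ∀ a b → replace S R A a b ≡ true → incB n k a b ≡ true
    ⊆Inc a b e with kept-or-added e
    ... | inj₁ (s , _) = S⊆Inc a b s
    ... | inj₂ added   = A⊆Inc a b added

    indep : ∀ a b x y → replace S R A a b ≡ true → replace S R A x y ≡ true → ¬ Adjacent a b x y
    indep a b x y e e′ adj with kept-or-added e | kept-or-added e′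
    ... | inj₁ (s , _) | inj₁ (s′ , _)  = S-indep a b x y s s′ adj
    ... | inj₂ added   | inj₁ (s′ , r′) = A-S a b x y added s′ r′ adj
    ... | inj₁ (s , r) | inj₂ added′    = A-S x y a b added′ s r (swap adj)
    ... | inj₂ added   | inj₂ added′    = A-A a b x y added added′ adj

  columnSet-¬Adjacent : ∀ {p c} → (∀ a b → columnSet p c a b ≡ true → incB n k a b ≡ true) →
    ∀ a b x y → columnSet p c a b ≡ true → columnSet p c x y ≡ true → ¬ Adjacent a b x y
  columnSet-¬Adjacent {p} {c} ⊆Inc a b x y ab xy (_ , x<b) =
    ltB⇒¬incB x y (subst (λ z → ltB n k x z ≡ true) b≡y x<b) (⊆Inc x y xy)
    where
    b≡y : b ≡ y
    b≡y = toℕ-injective (trans (proj₁ (columnSet⁻ p c ab)) (sym (proj₁ (columnSet⁻ p c xy))))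

  rowSet-¬Adjacent : ∀ {p c} → (∀ a b → rowSet p c a b ≡ true → incB n k a b ≡ true) →
    ∀ a b x y → rowSet p c a b ≡ true → rowSet p c x y ≡ true → ¬ Adjacent a b x y
  rowSet-¬Adjacent {p} {c} ⊆Inc a b x y ab xy (a<y , _) =
    ltB⇒¬incB x y (subst (λ z → ltB n k z y ≡ true) a≡x a<y) (⊆Inc x y xy)
    where
    a≡x : a ≡ x
    a≡x = toℕ-injective (trans (proj₁ (rowSet⁻ p c ab)) (sym (proj₁ (rowSet⁻ p c xy))))

-- Contraction blocking pairs

module Contraction (n k : ℕ) (S : PairSet (n + k)) (i : Fin (n + k)) where

  open Crown n k

  F L : PairSet (n + k)
  F = FCBP n k S i
  L = LCBP n k S i

  FCBP⁻ : ∀ {a b} → F a b ≡ true →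
          S a b ≡ true × a ≡ i × ∃[ x ] (S x i ≡ true × ltB n k x b ≡ true)
  FCBP⁻ {a} {b} e =
    let s , rest          = ∧-true⁻ {S a b} e
        a==i , blocked    = ∧-true⁻ {a == i} rest
        x , blocker       = any-allFin⁻ _ blocked
    in s , ==⇒≡ a==i , x , ∧-true⁻ {S x i} blocker

  LCBP⁻ : ∀ {x y} → L x y ≡ true →
          S x y ≡ true × y ≡ i × ∃[ b ] (S i b ≡ true × ltB n k x b ≡ true)
  LCBP⁻ {x} {y} e =
    let s , rest          = ∧-true⁻ {S x y} e
        y==i , blocked    = ∧-true⁻ {y == i} rest
        b , blocker       = any-allFin⁻ _ blocked
    in s , ==⇒≡ y==i , b , ∧-true⁻ {S i b} blocker

  FCBP-fst≡ : ∀ {a b} → F a b ≡ true → a ≡ i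
  FCBP-fst≡ = proj₁ ∘ proj₂ ∘ FCBP⁻

  LCBP-snd≡ : ∀ {x y} → L x y ≡ true → y ≡ i
  LCBP-snd≡ = proj₁ ∘ proj₂ ∘ LCBP⁻

  FCBP⁺ : ∀ {b x} → S i b ≡ true → S x i ≡ true → ltB n k x b ≡ true → F i b ≡ true
  FCBP⁺ {x = x} sib sxi x<b = ∧-true⁺ sib (∧-true⁺ (≡⇒== {u = i} refl) (any-allFin⁺ _ x (∧-true⁺ sxi x<b)))

  LCBP⁺ : ∀ {x b} → S x i ≡ true → S i b ≡ true → ltB n k x b ≡ true → L x i ≡ true
  LCBP⁺ {b = b} sxi sib x<b = ∧-true⁺ sxi (∧-true⁺ (≡⇒== {u = i} refl) (any-allFin⁺ _ b (∧-true⁺ sib x<b)))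

  FCBP-row : ∀ a b → F a b ≡ rowSet (toℕ i) (F i) a b
  FCBP-row a b = ∧-guard (λ a==i → cong (λ a → F a b) (==⇒≡ a==i)) (≡⇒== ∘ FCBP-fst≡)

  LCBP-column : ∀ x y → L x y ≡ columnSet (toℕ i) (λ x → L x i) x y
  LCBP-column x y = ∧-guard (λ y==i → cong (L x) (==⇒≡ y==i)) (≡⇒== ∘ LCBP-snd≡)

  LCBP-fsts : Fin (n + k) → Bool
  LCBP-fsts x = any (L x) (allFin (n + k))

  FCBP-snds : Fin (n + k) → Bool
  FCBP-snds b = any (λ a → F a b) (allFin (n + k))

  lowered : PairSet (n + k)
  lowered = columnSet (predIdx (n + k) i) LCBP-fsts

  raised : PairSet (n + k)
  raised = rowSet (succIdx (n + k) i) FCBP-snds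

  lowered⁻ : ∀ x v → lowered x v ≡ true → CyclicSucc (n + k) (toℕ v) (toℕ i) × L x i ≡ true
  lowered⁻ x v low =
    let v=i-1 , anyL = columnSet⁻ _ LCBP-fsts low
        y , lxy      = any-allFin⁻ (L x) anyL
    in  subst (λ t → CyclicSucc (n + k) t (toℕ i)) (sym v=i-1) (predIdx-cyclicSucc i)
      , subst (λ y → L x y ≡ true) (LCBP-snd≡ lxy) lxy

  raised⁻ : ∀ u b → raised u b ≡ true → CyclicSucc (n + k) (toℕ i) (toℕ u) × F i b ≡ true
  raised⁻ u b rai =
    let u=i+1 , anyF = rowSet⁻ _ FCBP-snds rai
        a , fab      = any-allFin⁻ (λ a → F a b) anyF
    in  subst (CyclicSucc (n + k) (toℕ i)) (sym u=i+1) (cyclicSucc-succIdx i)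
      , subst (λ a → F a b ≡ true) (FCBP-fst≡ fab) fab

  card-lowered : card lowered ≡ card L
  card-lowered = begin
    card lowered                        ≡⟨ card-column lowered _ i-1<N (λ _ _ → refl) ⟩
    ∑[ x < n + k ] indicator (LCBP-fsts x)
      ≡⟨ sum-cong-≗ (λ x → cong indicator (any-allFin-unique (L x) i λ _ → LCBP-snd≡)) ⟩
    ∑[ x < n + k ] indicator (L x i)    ≡⟨ card-column L _ (toℕ<n i) LCBP-column ⟨
    card L                              ∎
    where
    open ≡-Reasoning
    i-1<N : predIdx (n + k) i < n + k
    i-1<N = CyclicSucc-<ˡ (predIdx-cyclicSucc i)

  card-raised : card raised ≡ card F
  card-raised = begin
    card raised                         ≡⟨ card-row raised _ i+1<N (λ _ _ → refl) ⟩
    ∑[ b < n + k ] indicator (FCBP-snds b)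
      ≡⟨ sum-cong-≗ (λ b → cong indicator (any-allFin-unique (λ a → F a b) i λ _ → FCBP-fst≡)) ⟩
    ∑[ b < n + k ] indicator (F i b)    ≡⟨ card-row F _ (toℕ<n i) FCBP-row ⟨
    card F                              ∎
    where
    open ≡-Reasoning
    i+1<N : succIdx (n + k) i < n + k
    i+1<N = CyclicSucc-<ʳ (cyclicSucc-succIdx i)

  module _ (ind : Independent n k S) where

    private
      S⊆Inc : ∀ a b → S a b ≡ true → incB n k a b ≡ true
      S⊆Inc = proj₁ ind
      S-indep : ∀ a b x y → S a b ≡ true → S x y ≡ true → ¬ Adjacent a b x y
      S-indep = proj₂ ind

    LCBP-fst≢ : ∀ {x y} → L x y ≡ true → x ≢ i
    LCBP-fst≢ lxy refl = let _ , _ , b , sib , i<b = LCBP⁻ lxy in ltB⇒¬incB i b i<b (S⊆Inc i b sib)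

    FCBP-snd≢ : ∀ {a b} → F a b ≡ true → b ≢ i
    FCBP-snd≢ fab refl = let _ , _ , x , sxi , x<i = FCBP⁻ fab in ltB⇒¬incB x i x<i (S⊆Inc x i sxi)

    lowered⊆Inc : ∀ x v → lowered x v ≡ true → incB n k x v ≡ true
    lowered⊆Inc x v low =
      let v↝i , lxi = lowered⁻ x v low in
      incB-predʳ {x} {v} {i} v↝i (LCBP-fst≢ lxi) (S⊆Inc x i (proj₁ (LCBP⁻ lxi)))

    raised⊆Inc : ∀ u b → raised u b ≡ true → incB n k u b ≡ true
    raised⊆Inc u b rai =
      let i↝u , fib = raised⁻ u b rai in
      incB-succˡ {u} {b} {i} i↝u (FCBP-snd≢ fib) (S⊆Inc i b (proj₁ (FCBP⁻ fib)))

    lowered-¬Adjacent : ∀ x v u w → lowered x v ≡ true → S u w ≡ true → F u w ≡ false →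
                        ¬ Adjacent x v u w
    lowered-¬Adjacent x v u w low suw ¬fuw (x<w , u<v) with lowered⁻ x v low | incB n k u i in u∥i
    ... | _ , lxi | false = S-indep x i u w (proj₁ (LCBP⁻ lxi)) suw (x<w , cong not u∥i)
    ... | v↝i , lxi | true with u ≟ i
    ...   | yes refl = contradiction (trans (sym ¬fuw) (FCBP⁺ suw (proj₁ (LCBP⁻ lxi)) x<w)) λ ()
    ...   | no u≢i   = ltB⇒¬incB u v u<v (incB-predʳ {u} {v} {i} v↝i u≢i u∥i)

    raised-¬Adjacent : ∀ u b x y → raised u b ≡ true → S x y ≡ true → L x y ≡ false →
                       ¬ Adjacent u b x y
    raised-¬Adjacent u b x y rai sxy ¬lxy (u<y , x<b) with raised⁻ u b rai | incB n k i y in i∥y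
    ... | _ , fib | false = S-indep i b x y (proj₁ (FCBP⁻ fib)) sxy (cong not i∥y , x<b)
    ... | i↝u , fib | true with y ≟ i
    ...   | yes refl = contradiction (trans (sym ¬lxy) (LCBP⁺ sxy (proj₁ (FCBP⁻ fib)) x<b)) λ ()
    ...   | no y≢i   = ltB⇒¬incB u y u<y (incB-succˡ {u} {y} {i} i↝u y≢i i∥y)

    -- (x, b_{i-1}) would be adjacent to the pair (a_i, b) blocking (x, b_i), as a_i < b_{i-1}.
    lowered∩S≡∅ : 2 ≤ n → ∀ x v → lowered x v ≡ true → S x v ≡ false
    lowered∩S≡∅ 2≤n x v low = ¬-not λ sxv →
      let v↝i , lxi = lowered⁻ x v low
          _ , _ , b , sib , x<b = LCBP⁻ lxi
      in S-indep x v i b sxv sib (x<b , ltB-cyclicSucc 2≤n {v} {i} v↝i)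

    raised∩S≡∅ : 2 ≤ n → ∀ u b → raised u b ≡ true → S u b ≡ false
    raised∩S≡∅ 2≤n u b rai = ¬-not λ sub →
      let i↝u , fib = raised⁻ u b rai
          _ , _ , x , sxi , x<b = FCBP⁻ fib
      in S-indep x i u b sxi sub (x<b , ltB-cyclicSucc 2≤n {i} {u} i↝u)

    DFCL-independent : Independent n k (DFCL n k S i)
    DFCL-independent =
      replace-independent ind lowered⊆Inc lowered-¬Adjacent (columnSet-¬Adjacent lowered⊆Inc)

    DLCF-independent : Independent n k (DLCF n k S i)
    DLCF-independent =
      replace-independent ind raised⊆Inc raised-¬Adjacent (rowSet-¬Adjacent raised⊆Inc)

    card-DFCL : 2 ≤ n → card (DFCL n k S i) + card F ≡ card S + card L
    card-DFCL 2≤n = trans (card-replace S F lowered (λ _ _ → proj₁ ∘ FCBP⁻) (lowered∩S≡∅ 2≤n))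
                          (cong (card S +_) card-lowered)

    card-DLCF : 2 ≤ n → card (DLCF n k S i) + card L ≡ card S + card F
    card-DLCF 2≤n = trans (card-replace S L raised (λ _ _ → proj₁ ∘ LCBP⁻) (raised∩S≡∅ 2≤n))
                          (cong (card S +_) card-raised)

    card-DFCL+card-DLCF : 2 ≤ n → card (DFCL n k S i) + card (DLCF n k S i) ≡ 2 * card S
    card-DFCL+card-DLCF 2≤n =
      exchanges⇒double (card (DFCL n k S i)) (card (DLCF n k S i)) (card F) (card L) (card S)
                       (card-DFCL 2≤n) (card-DLCF 2≤n)

lemma4p7 : (n k : ℕ) → 3 ≤ n → (S : PairSet (n + k)) → Independent n k S →
    (i : Fin (n + k)) →
    Independent n k (DFCL n k S i) × Independent n k (DLCF n k S i) ×
    (card (DFCL n k S i) + card (DLCF n k S i) ≡ 2 * card S)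
lemma4p7 n k 3≤n S ind i =
  DFCL-independent ind , DLCF-independent ind , card-DFCL+card-DLCF ind (<⇒≤ 3≤n)
  where open Contraction n k S i
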